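{- Let $v$ be a non-exposed vertex of degree at least one in a tree $T$ of the underlying forest, where $T$ has at most one exposed vertex, and let $\mathcal T$ be a top tree for $T$ in which all clusters are valid and the orientation invariant holds. Let $c$ be the consuming node of $v$. The node returned by $\mathrm{prepare\_expose}(c)$ is the consuming node of $v$ in the top tree after the changes made by $\mathrm{prepare\_expose}$.
   Context: Let $F$ be a forest (the underlying forest) in which some vertices are marked as exposed. For a set $C$ of edges of $F$, a vertex $w$ is a boundary vertex of $C$ if $w$ is incident to an edge of $C$ and either $w$ is exposed or $w$ is incident to an edge of $F$ not in $C$. A cluster is a nonempty connected set of edges; it is valid if it has at most two boundary vertices; a valid cluster is a path cluster if it has exactly two boundary vertices and a point cluster if it has zero or one. A top tree for a tree $T$ of $F$ (with at least one edge) is a rooted tree in which every internal node has exactly two children and whose leaves are in bijection with the edges of $T$; each node is identified with the cluster of edges at the leaves of its subtree, every such cluster being connected and valid. The two children of an internal node share exactly one vertex, its central vertex. The consuming node of a vertex $v$ is the lowest common ancestor in the top tree of all leaves corresponding to edges incident to $v$. Orientation: each internal node has ordered children (left, right), each leaf has ordered endpoints (left, right). For a leaf, a boundary vertex is its left/right boundary vertex if it is its left/right endpoint; for an internal node, a boundary vertex is middle if it equals the central vertex, and otherwise left/right according to whether it is a boundary vertex of the left/right child. Leftmost boundary vertex: the left one if it exists, else the middle one if it exists, else none; rightmost symmetric. Orientation invariant: for every internal node, the rightmost boundary vertex of the left child and the leftmost boundary vertex of the right child exist and equal the central vertex. Two nodes hang off to the same side if both are left children or both are right children of their respective parents. Rotation: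 for a node $u$ with parent $y$ and grandparent $z$, with $a=\mathrm{sibling}(u)$, $b=\mathrm{sibling}(y)$, $\mathrm{rotate\_up}(u)$ makes $a,b$ the children of $y$ and $u,y$ the children of $z$ (other parent–child relations unchanged), then adjusts child orders and orientations (possibly reversing orientations of whole subtrees) so that the orientation invariant holds. Procedure $\mathrm{prepare\_expose}(c)$: set $\mathrm{node}=c$. While $\mathrm{node}$ is not the root: let $\mathrm{parent}$ be its parent. If $\mathrm{node}$ is a point cluster, set $\mathrm{node}=\mathrm{parent}$. Otherwise let $s=\mathrm{sibling}(\mathrm{node})$ and let $q$ be the child of $\mathrm{node}$ on the same side as $s$ (the left child of $\mathrm{node}$ if $s$ is a left child, the right child otherwise). If $q$ is a path cluster or $s$ is a point cluster: perform $\mathrm{rotate\_up}$ on the other child of $\mathrm{node}$ (the one different from $q$); if $\mathrm{node}=c$ then set $c=\mathrm{parent}$; set $\mathrm{node}=\mathrm{parent}$. Otherwise let $u=\mathrm{sibling}(\mathrm{parent})$; if $s$ and $u$ hang off to the same side perform $\mathrm{rotate\_up}(\mathrm{node})$, else perform $\mathrm{rotate\_up}(s)$ (and leave $\mathrm{node}$ unchanged). When the loop ends, return $c$. -}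

module Defs where

open import Data.Nat using (ℕ; _≤_; _≡ᵇ_; _≟_)
open import Data.Bool using (Bool; true; false; _∧_; _∨_; not; if_then_else_)
open import Data.List using (List; []; _∷_; _++_; [_]; _∷ʳ_; length; concatMap; filterᵇ; deduplicate; map)
open import Data.List.Membership.Propositional using (_∈_)
open import Data.List.Relation.Unary.Any using (Any)
open import Data.List.Relation.Unary.All using (All)
open import Data.List.Relation.Unary.AllPairs using (AllPairs)
open import Data.List.Relation.Unary.Unique.Propositional using (Unique)
open import Data.Bool.ListAction using (any)
open import Data.Maybe using (Maybe; just; nothing)
open import Data.Product using (_×_; _,_; Σ; ∃; proj₁; proj₂)
open import Data.Sum using (_⊎_)
open import Data.Empty using (⊥)
open import Relation.Nullary using (¬_)
open import Relation.Binary.PropositionalEquality using (_≡_; _≢_)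

-- Graphs: vertices are natural numbers, an edge is a pair of vertices.
-- Edges of the (simple) forest are unordered; (a , b) and (b , a) denote
-- the same edge.

Edge : Set
Edge = ℕ × ℕ

SameEdge : Edge → Edge → Set
SameEdge (a , b) (c , d) = (a ≡ c × b ≡ d) ⊎ (a ≡ d × b ≡ c)

Inc : ℕ → Edge → Set
Inc w (a , b) = (w ≡ a) ⊎ (w ≡ b)

verts : List Edge → List ℕ
verts = concatMap (λ e → proj₁ e ∷ proj₂ e ∷ [])

Adj : List Edge → ℕ → ℕ → Set
Adj G x y = Any (SameEdge (x , y)) G

ChainAdj : List Edge → List ℕ → Set
ChainAdj G [] = Data.Unit.⊤ where import Data.Unit
ChainAdj G (x ∷ []) = Data.Unit.⊤ where import Data.Unit
ChainAdj G (x ∷ y ∷ r) = Adj G x y × ChainAdj G (y ∷ r)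

Cycle : List Edge → ℕ → List ℕ → Set
Cycle G x vs = (2 ≤ length vs) × Unique (x ∷ vs) × ChainAdj G (x ∷ vs ∷ʳ x)

IsForest : List Edge → Set
IsForest F = All (λ e → proj₁ e ≢ proj₂ e) F
           × AllPairs (λ e e′ → ¬ SameEdge e e′) F
           × (∀ x vs → ¬ Cycle F x vs)

data Reach (C : List Edge) : ℕ → ℕ → Set where
  reach-refl : ∀ {x} → Reach C x x
  reach-step : ∀ {x y z} → Reach C x y → Adj C y z → Reach C x z

Connected : List Edge → Set
Connected C = (C ≢ []) × (∀ x y → x ∈ verts C → y ∈ verts C → Reach C x y)

-- Boundary vertices (F : forest, E : exposed-vertex marking)

incᵇ : ℕ → Edge → Bool
incᵇ w (a , b) = (w ≡ᵇ a) ∨ (w ≡ᵇ b)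

sameᵇ : Edge → Edge → Bool
sameᵇ (a , b) (c , d) = ((a ≡ᵇ c) ∧ (b ≡ᵇ d)) ∨ ((a ≡ᵇ d) ∧ (b ≡ᵇ c))

memᵇ : Edge → List Edge → Bool
memᵇ e C = any (sameᵇ e) C

isBd : List Edge → (ℕ → Bool) → List Edge → ℕ → Bool
isBd F E C w = any (incᵇ w) C ∧ (E w ∨ any (λ e → incᵇ w e ∧ not (memᵇ e C)) F)

Bd : List Edge → (ℕ → Bool) → List Edge → ℕ → Set
Bd F E C w = isBd F E C w ≡ true

bdVerts : List Edge → (ℕ → Bool) → List Edge → List ℕ
bdVerts F E C = deduplicate _≟_ (filterᵇ (isBd F E C) (verts C))

nBd : List Edge → (ℕ → Bool) → List Edge → ℕ
nBd F E C = length (bdVerts F E C)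

-- Every node carries an identifier (to track node identity
-- through rotations).  A leaf  leaf i a b  is the edge {a,b} with left
-- endpoint a and right endpoint b; an internal node  node i l r  has left
-- child l and right child r.

data TT : Set where
  leaf : (i a b : ℕ) → TT
  node : (i : ℕ) → (l r : TT) → TT

idOf : TT → ℕ
idOf (leaf i _ _) = i
idOf (node i _ _) = i

ids : TT → List ℕ
ids (leaf i _ _) = i ∷ []
ids (node i l r) = i ∷ ids l ++ ids r

leaves : TT → List Edge
leaves (leaf _ a b) = (a , b) ∷ []
leaves (node _ l r) = leaves l ++ leaves r

leafList : TT → List (ℕ × Edge)
leafList (leaf i a b) = (i , (a , b)) ∷ []
leafList (node _ l r) = leafList l ++ leafList r

Cl : TT → List Edge
Cl = leaves

PointCl : List Edge → (ℕ → Bool) → TT → Set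
PointCl F E s = nBd F E (Cl s) ≤ 1

PathCl : List Edge → (ℕ → Bool) → TT → Set
PathCl F E s = nBd F E (Cl s) ≡ 2

Valid : List Edge → (ℕ → Bool) → TT → Set
Valid F E s = nBd F E (Cl s) ≤ 2

data Dir : Set where
  L R : Dir

-- position of a node: the list of frames from the node up to the root;
-- each frame records on which side the current node hangs off its parent,
-- the parent's identifier, and the sibling subtree.
record Frame : Set where
  constructor frame
  field
    side : Dir
    pid  : ℕ
    sib  : TT
open Frame public

-- Path i t s fs : s is the subtree of t whose root has identifier i, and
-- fs are its frames (innermost first).
data Path (i : ℕ) : TT → TT → List Frame → Set where
  here : ∀ {s} → idOf s ≡ i → Path i s s []
  inL  : ∀ {j l r s fs} → Path i l s fs → Path i (node j l r) s (fs ∷ʳ frame L j r)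
  inR  : ∀ {j l r s fs} → Path i r s fs → Path i (node j l r) s (fs ∷ʳ frame R j l)

AllNodes : (TT → Set) → TT → Set
AllNodes P t = ∀ i s fs → Path i t s fs → P s

Central : TT → ℕ → Set
Central (leaf _ _ _) w = ⊥
Central (node _ x y) w = (w ∈ verts (Cl x)) × (w ∈ verts (Cl y))

LeftBd : List Edge → (ℕ → Bool) → TT → ℕ → Set
LeftBd F E s@(leaf _ a b) w = (w ≡ a) × Bd F E (Cl s) w
LeftBd F E s@(node _ x y) w = Bd F E (Cl s) w × ¬ Central s w × Bd F E (Cl x) w

RightBd : List Edge → (ℕ → Bool) → TT → ℕ → Set
RightBd F E s@(leaf _ a b) w = (w ≡ b) × Bd F E (Cl s) w
RightBd F E s@(node _ x y) w = Bd F E (Cl s) w × ¬ Central s w × Bd F E (Cl y) w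

MiddleBd : List Edge → (ℕ → Bool) → TT → ℕ → Set
MiddleBd F E s w = Bd F E (Cl s) w × Central s w

Leftmost : List Edge → (ℕ → Bool) → TT → ℕ → Set
Leftmost F E s w = LeftBd F E s w ⊎ (MiddleBd F E s w × (∀ w′ → ¬ LeftBd F E s w′))

Rightmost : List Edge → (ℕ → Bool) → TT → ℕ → Set
Rightmost F E s w = RightBd F E s w ⊎ (MiddleBd F E s w × (∀ w′ → ¬ RightBd F E s w′))

OrientAt : List Edge → (ℕ → Bool) → TT → Set
OrientAt F E (leaf _ _ _) = Data.Unit.⊤ where import Data.Unit
OrientAt F E s@(node _ x y) =
  ∃ (λ m → Central s m × (∀ w → Rightmost F E x w → w ≡ m) × Rightmost F E x m
                       × (∀ w → Leftmost F E y w → w ≡ m) × Leftmost F E y m)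

OrientInv : List Edge → (ℕ → Bool) → TT → Set
OrientInv F E t = AllNodes (OrientAt F E) t

-- t is a top tree for the tree T of F consisting of the edges at its leaves:
-- ids unique; leaves are edges of F, pairwise distinct, and every edge of F
-- touching a vertex of T is a leaf (T is a whole component of F); every
-- cluster is connected and valid.
TopTree : List Edge → (ℕ → Bool) → TT → Set
TopTree F E t = Unique (ids t)
              × All (λ e → Any (SameEdge e) F) (leaves t)
              × AllPairs (λ e e′ → ¬ SameEdge e e′) (leaves t)
              × (∀ e → e ∈ F → ∀ w → w ∈ verts (leaves t) → Inc w e → Any (SameEdge e) (leaves t))
              × AllNodes (λ s → Connected (Cl s) × Valid F E s) t

AtMostOneExposed : (ℕ → Bool) → TT → Set
AtMostOneExposed E t = ∀ w w′ → w ∈ verts (leaves t) → w′ ∈ verts (leaves t)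
                     → E w ≡ true → E w′ ≡ true → w ≡ w′

-- consuming node: lowest common ancestor of the leaves incident to v,
-- i.e. the node containing all of them none of whose children does
ContainsAll : TT → ℕ → TT → Set
ContainsAll t v s = ∀ j e → (j , e) ∈ leafList t → Inc v e → j ∈ map proj₁ (leafList s)

ChildOf : TT → TT → Set
ChildOf (leaf _ _ _) ch = ⊥
ChildOf (node _ x y) ch = (ch ≡ x) ⊎ (ch ≡ y)

Consuming : TT → ℕ → ℕ → Set
Consuming t v i = Σ TT λ s → Σ (List Frame) λ fs →
  Path i t s fs × ContainsAll t v s × (∀ ch → ChildOf s ch → ¬ ContainsAll t v ch)

-- Child orders are irrelevant here (see RotUp).
try : ℕ → ℕ → TT → TT → Maybe TT
try u z (leaf _ _ _) o = nothing
try u z (node yi a b) o =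
  if idOf a ≡ᵇ u then just (node z a (node yi b o))
  else (if idOf b ≡ᵇ u then just (node z b (node yi a o)) else nothing)

rotRaw : ℕ → TT → TT
rotRaw u (leaf i a b) = leaf i a b
rotRaw u (node z l r) with try u z l r
... | just t = t
... | nothing with try u z r l
...   | just t = t
...   | nothing = node z (rotRaw u l) (rotRaw u r)

data Reorient : TT → TT → Set where
  leaf-same : ∀ {i a b} → Reorient (leaf i a b) (leaf i a b)
  leaf-flip : ∀ {i a b} → Reorient (leaf i a b) (leaf i b a)
  node-same : ∀ {i l r l′ r′} → Reorient l l′ → Reorient r r′ → Reorient (node i l r) (node i l′ r′)
  node-swap : ∀ {i l r l′ r′} → Reorient l l′ → Reorient r r′ → Reorient (node i l r) (node i r′ l′)

-- rotate_up(u) turns t into t′: structural rotation, followed by any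
-- adjustment of child orders and orientations after which the orientation
-- invariant holds
RotUp : List Edge → (ℕ → Bool) → ℕ → TT → TT → Set
RotUp F E u t t′ = Reorient (rotRaw u t) t′ × OrientInv F E t′

-- prepare_expose as a transition system on states (tree, node, c)

record State : Set where
  constructor st
  field
    tree : TT
    cur  : ℕ
    cc   : ℕ

-- q = child of node on the same side as its sibling s (node hangs off on
-- side d, so s hangs off on the other side); o = the other child
qChild : Dir → TT → TT → TT
qChild R x y = x
qChild L x y = y

oChild : Dir → TT → TT → TT
oChild R x y = y
oChild L x y = x

data Step (F : List Edge) (E : ℕ → Bool) : State → State → Set where
  up-point : ∀ {t nd c sub f fs} → Path nd t sub (f ∷ fs) → PointCl F E sub
           → Step F E (st t nd c) (st t (pid f) c)
  rot-child : ∀ {t t′ nd c x y f fs} → Path nd t (node nd x y) (f ∷ fs)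
            → ¬ PointCl F E (node nd x y)
            → PathCl F E (qChild (side f) x y) ⊎ PointCl F E (sib f)
            → RotUp F E (idOf (oChild (side f) x y)) t t′
            → Step F E (st t nd c) (st t′ (pid f) (if nd ≡ᵇ c then pid f else c))
  rot-node : ∀ {t t′ nd c x y f f₂ fs} → Path nd t (node nd x y) (f ∷ f₂ ∷ fs)
           → ¬ PointCl F E (node nd x y)
           → ¬ PathCl F E (qChild (side f) x y) → ¬ PointCl F E (sib f)
           → side f ≡ side f₂
           → RotUp F E nd t t′
           → Step F E (st t nd c) (st t′ nd c)
  rot-sib : ∀ {t t′ nd c x y f f₂ fs} → Path nd t (node nd x y) (f ∷ f₂ ∷ fs)
          → ¬ PointCl F E (node nd x y)
          → ¬ PathCl F E (qChild (side f) x y) → ¬ PointCl F E (sib f)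
          → side f ≢ side f₂
          → RotUp F E (idOf (sib f)) t t′
          → Step F E (st t nd c) (st t′ nd c)

-- Along a run of prepare_expose we track two subtrees: the
-- current node n and, inside it, the consuming node c of v.  A rotation keeps
-- the set of identifiers and, up to reorientation, the set of leaves, and it
-- keeps as a subtree every node w that does not contain the rotated node
-- strictly below w.  All rotations happen at or above n, so c survives them
-- and remains the lowest node containing every leaf at v.  The exception is
-- rotate_up of a child of n = c: the leaves at v lie in both children of c,
-- which now hang under the parent on different sides, so the parent becomes
-- the consuming node, as prepare_expose records by setting c to it.

module Submission where

open import Defs
open import Data.Nat using (ℕ; _≡ᵇ_; _≟_)
open import Data.Nat.Properties using (≡ᵇ⇒≡)
open import Data.Bool using (Bool; true; false; T; if_then_else_)
open import Data.List using (List; []; _∷_; _++_; map)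
import Data.List.Properties as List
open import Data.List.Membership.Propositional using (_∈_; _∉_)
open import Data.List.Membership.Propositional.Properties using (∈-++⁺ˡ; ∈-++⁺ʳ; ∈-++⁻; ∈-map⁺; ∈-map⁻)
open import Data.List.Relation.Unary.Any using (here; there)
import Data.List.Relation.Unary.All as All
import Data.List.Relation.Unary.All.Properties as All
open import Data.List.Relation.Unary.AllPairs using ([]; _∷_)
open import Data.List.Relation.Unary.Unique.Propositional using (Unique)
open import Data.List.Relation.Binary.Subset.Propositional using (_⊆_)
open import Data.List.Relation.Binary.Disjoint.Propositional using (Disjoint)
open import Data.List.Relation.Binary.Permutation.Propositional using (_↭_; ↭-refl; ↭-sym; ↭-trans; ↭-prep; ↭⇒↭ₛ)
open import Data.List.Relation.Binary.Permutation.Propositional.Properties using (∈-resp-↭; ++⁺; ++⁺ˡ; ++-comm; shifts)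
open import Data.List.Relation.Binary.Permutation.Setoid.Properties using (AllPairs-resp-↭)
open import Data.Maybe using (just; nothing)
open import Data.Product using (∃; _×_; _,_; proj₁; proj₂)
import Data.Product as Product
open import Data.Sum using (inj₁; inj₂; [_,_]′)
import Data.Sum as Sum
open import Data.Empty using (⊥-elim)
open import Function using (_∘_; case_of_)
open import Relation.Nullary using (¬_)
open import Relation.Nullary.Decidable using (dec-true; dec-false)
open import Relation.Binary.PropositionalEquality
open import Relation.Binary.Construct.Closure.ReflexiveTransitive using (Star; ε; _◅_)

unique-resp-↭ : ∀ {A : Set} {xs ys : List A} → xs ↭ ys → Unique xs → Unique ys
unique-resp-↭ p = AllPairs-resp-↭ (setoid _) ≢-sym (resp₂ _≢_) (↭⇒↭ₛ p)

unique-++⁻ : ∀ {A : Set} (xs : List A) {ys} → Unique (xs ++ ys) → Unique xs × Unique ys × Disjoint xs ys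
unique-++⁻ [] u = [] , u , λ { (() , _) }
unique-++⁻ (x ∷ xs) (x∉ ∷ u) with unique-++⁻ xs u
... | uxs , uys , disj = All.++⁻ˡ xs x∉ ∷ uxs , uys , λ
  { (here refl , y∈) → All.lookup (All.++⁻ʳ xs x∉) y∈ refl
  ; (there x∈ , y∈) → disj (x∈ , y∈) }

≡ᵇ≡true⇒≡ : ∀ {m n} → (m ≡ᵇ n) ≡ true → m ≡ n
≡ᵇ≡true⇒≡ {m} {n} e = ≡ᵇ⇒≡ m n (subst T (sym e) _)

-- `does (m ≟ n)` computes to `m ≡ᵇ n`.
≡⇒≡ᵇ≡true : ∀ {m n} → m ≡ n → (m ≡ᵇ n) ≡ true
≡⇒≡ᵇ≡true {m} {n} = dec-true (m ≟ n)

≢⇒≡ᵇ≡false : ∀ {m n} → m ≢ n → (m ≡ᵇ n) ≡ false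
≢⇒≡ᵇ≡false {m} {n} = dec-false (m ≟ n)

data _⊑_ (w : TT) : TT → Set where
  ⊑-here  : w ⊑ w
  ⊑-left  : ∀ {i l r} → w ⊑ l → w ⊑ node i l r
  ⊑-right : ∀ {i l r} → w ⊑ r → w ⊑ node i l r

⊑-trans : ∀ {a b c} → a ⊑ b → b ⊑ c → a ⊑ c
⊑-trans p ⊑-here = p
⊑-trans p (⊑-left q) = ⊑-left (⊑-trans p q)
⊑-trans p (⊑-right q) = ⊑-right (⊑-trans p q)

inner : TT → List ℕ
inner (leaf _ _ _) = []
inner (node _ l r) = ids l ++ ids r

idOf∈ids : ∀ t → idOf t ∈ ids t
idOf∈ids (leaf i a b) = here refl
idOf∈ids (node i l r) = here refl

inner⊆ids : ∀ t → inner t ⊆ ids t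
inner⊆ids (node i l r) = there

⊑-ids : ∀ {w t} → w ⊑ t → ids w ⊆ ids t
⊑-ids ⊑-here = λ m → m
⊑-ids (⊑-left p) = there ∘ ∈-++⁺ˡ ∘ ⊑-ids p
⊑-ids (⊑-right {l = l} p) = there ∘ ∈-++⁺ʳ (ids l) ∘ ⊑-ids p

⊑-inner : ∀ {w t} → w ⊑ t → inner w ⊆ inner t
⊑-inner ⊑-here = λ m → m
⊑-inner {w} (⊑-left p) = ∈-++⁺ˡ ∘ ⊑-ids p ∘ inner⊆ids w
⊑-inner {w} (⊑-right {l = l} p) = ∈-++⁺ʳ (ids l) ∘ ⊑-ids p ∘ inner⊆ids w

data DistinctIds : TT → Set where
  distinct-leaf : ∀ {i a b} → DistinctIds (leaf i a b)
  distinct-node : ∀ {i l r} → i ∉ ids l → i ∉ ids r → Disjoint (ids l) (ids r)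
                → DistinctIds l → DistinctIds r → DistinctIds (node i l r)

unique⇒distinct : ∀ {t} → Unique (ids t) → DistinctIds t
unique⇒distinct {leaf _ _ _} _ = distinct-leaf
unique⇒distinct {node i l r} (i∉ ∷ u) with unique-++⁻ (ids l) u
... | ul , ur , disj =
  distinct-node (All.All¬⇒¬Any (All.++⁻ˡ (ids l) i∉)) (All.All¬⇒¬Any (All.++⁻ʳ (ids l) i∉))
                disj (unique⇒distinct ul) (unique⇒distinct ur)

root∉inner : ∀ {t} → DistinctIds t → idOf t ∉ inner t
root∉inner (distinct-node {l = l} i∉l i∉r _ _ _) m with ∈-++⁻ (ids l) m
... | inj₁ m′ = i∉l m′
... | inj₂ m′ = i∉r m′

⊑-distinct : ∀ {w t} → DistinctIds t → w ⊑ t → DistinctIds w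
⊑-distinct d ⊑-here = d
⊑-distinct (distinct-node _ _ _ dl _) (⊑-left p) = ⊑-distinct dl p
⊑-distinct (distinct-node _ _ _ _ dr) (⊑-right p) = ⊑-distinct dr p

child-⊑-id≢ : ∀ {t ch w} → DistinctIds t → ChildOf t ch → w ⊑ ch → idOf t ≢ idOf w
child-⊑-id≢ {w = w} (distinct-node i∉l _ _ _ _) (inj₁ refl) q e =
  i∉l (subst (_∈ _) (sym e) (⊑-ids q (idOf∈ids w)))
child-⊑-id≢ {w = w} (distinct-node _ i∉r _ _ _) (inj₂ refl) q e =
  i∉r (subst (_∈ _) (sym e) (⊑-ids q (idOf∈ids w)))

⊑-id-injective : ∀ {a b t} → DistinctIds t → a ⊑ t → b ⊑ t → idOf a ≡ idOf b → a ≡ b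
⊑-id-injective _ ⊑-here ⊑-here _ = refl
⊑-id-injective d ⊑-here (⊑-left q) e = ⊥-elim (child-⊑-id≢ d (inj₁ refl) q e)
⊑-id-injective d ⊑-here (⊑-right q) e = ⊥-elim (child-⊑-id≢ d (inj₂ refl) q e)
⊑-id-injective d (⊑-left p) ⊑-here e = ⊥-elim (child-⊑-id≢ d (inj₁ refl) p (sym e))
⊑-id-injective d (⊑-right p) ⊑-here e = ⊥-elim (child-⊑-id≢ d (inj₂ refl) p (sym e))
⊑-id-injective (distinct-node _ _ _ dl _) (⊑-left p) (⊑-left q) e = ⊑-id-injective dl p q e
⊑-id-injective (distinct-node _ _ _ _ dr) (⊑-right p) (⊑-right q) e = ⊑-id-injective dr p q e
⊑-id-injective {a} {b} (distinct-node _ _ disj _ _) (⊑-left p) (⊑-right q) e =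
  ⊥-elim (disj (⊑-ids p (idOf∈ids a) , subst (_∈ _) (sym e) (⊑-ids q (idOf∈ids b))))
⊑-id-injective {a} {b} (distinct-node _ _ disj _ _) (⊑-right p) (⊑-left q) e =
  ⊥-elim (disj (⊑-ids q (idOf∈ids b) , subst (_∈ _) e (⊑-ids p (idOf∈ids a))))

attach : Frame → TT → TT
attach (frame L j r) s = node j s r
attach (frame R j l) s = node j l s

attach-id : ∀ f s → idOf (attach f s) ≡ pid f
attach-id (frame L _ _) _ = refl
attach-id (frame R _ _) _ = refl

⊑-attach : ∀ f s → s ⊑ attach f s
⊑-attach (frame L _ _) _ = ⊑-left ⊑-here
⊑-attach (frame R _ _) _ = ⊑-right ⊑-here

attach-disjoint : ∀ f {s} → DistinctIds (attach f s) → Disjoint (ids s) (ids (sib f))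
attach-disjoint (frame L _ _) (distinct-node _ _ disj _ _) = disj
attach-disjoint (frame R _ _) (distinct-node _ _ disj _ _) = disj ∘ Product.swap

path-id : ∀ {i t s fs} → Path i t s fs → idOf s ≡ i
path-id (here e) = e
path-id (inL p) = path-id p
path-id (inR p) = path-id p

path⇒⊑ : ∀ {i t s fs} → Path i t s fs → s ⊑ t
path⇒⊑ (here _) = ⊑-here
path⇒⊑ (inL p) = ⊑-left (path⇒⊑ p)
path⇒⊑ (inR p) = ⊑-right (path⇒⊑ p)

⊑⇒path : ∀ {s t} → s ⊑ t → ∃ λ fs → Path (idOf s) t s fs
⊑⇒path ⊑-here = [] , here refl
⊑⇒path (⊑-left p) = _ , inL (proj₂ (⊑⇒path p))
⊑⇒path (⊑-right p) = _ , inR (proj₂ (⊑⇒path p))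

path-unique : ∀ {i t s fs w} → Unique (ids t) → Path i t s fs → w ⊑ t → idOf w ≡ i → s ≡ w
path-unique uniq p w⊑ w-id =
  ⊑-id-injective (unique⇒distinct uniq) (path⇒⊑ p) w⊑ (trans (path-id p) (sym w-id))

-- `Path` indexes its frames as `fs ∷ʳ f`, which does not unify with a cons
-- pattern; hence the explicit equations on the frame list.
path-root : ∀ {i t s fs} → Path i t s fs → fs ≡ [] → s ≡ t
path-root (here _) _ = refl
path-root (inL {fs = []} _) ()
path-root (inL {fs = _ ∷ _} _) ()
path-root (inR {fs = []} _) ()
path-root (inR {fs = _ ∷ _} _) ()

path-parent : ∀ {i t s fs f gs} → Path i t s fs → fs ≡ f ∷ gs → attach f s ⊑ t
path-parent (inL {fs = []} p) refl rewrite path-root p refl = ⊑-here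
path-parent (inL {fs = _ ∷ _} p) refl = ⊑-left (path-parent p refl)
path-parent (inR {fs = []} p) refl rewrite path-root p refl = ⊑-here
path-parent (inR {fs = _ ∷ _} p) refl = ⊑-right (path-parent p refl)

ChildId : TT → ℕ → Set
ChildId y u = ∃ λ ch → ChildOf y ch × idOf ch ≡ u

childId∈inner : ∀ {y u} → ChildId y u → u ∈ inner y
childId∈inner {node _ l r} (_ , inj₁ refl , refl) = ∈-++⁺ˡ (idOf∈ids l)
childId∈inner {node _ l r} (_ , inj₂ refl , refl) = ∈-++⁺ʳ (ids l) (idOf∈ids r)

data Lift (u z : ℕ) : TT → TT → TT → Set where
  lift-left  : ∀ {y a b o} → idOf a ≡ u → Lift u z (node y a b) o (node z a (node y b o))
  lift-right : ∀ {y a b o} → idOf b ≡ u → Lift u z (node y a b) o (node z b (node y a o))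

lift-childId : ∀ {u z y o r} → Lift u z y o r → ChildId y u
lift-childId (lift-left e) = _ , inj₁ refl , e
lift-childId (lift-right e) = _ , inj₂ refl , e

try⇒lift : ∀ {u z} y o {r} → try u z y o ≡ just r → Lift u z y o r
try⇒lift {u} (node _ a b) o e with idOf a ≡ᵇ u in ea
... | true with refl ← e = lift-left (≡ᵇ≡true⇒≡ ea)
... | false with idOf b ≡ᵇ u in eb
...   | true with refl ← e = lift-right (≡ᵇ≡true⇒≡ eb)
...   | false = case e of λ ()

try-nothing : ∀ {u z} y o → try u z y o ≡ nothing → ¬ ChildId y u
try-nothing (node _ a b) o e (_ , inj₁ refl , refl) with idOf a ≡ᵇ idOf a | ≡⇒≡ᵇ≡true {idOf a} refl
... | true | _ = case e of λ ()
try-nothing (node _ a b) o e (_ , inj₂ refl , refl) with idOf a ≡ᵇ idOf b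
... | true = case e of λ ()
... | false with idOf b ≡ᵇ idOf b | ≡⇒≡ᵇ≡true {idOf b} refl
...   | true | _ = case e of λ ()

-- The graph of `rotRaw u`, with each failed `try` recorded as `¬ ChildId`.
data Rotation (u : ℕ) : TT → TT → Set where
  at-leaf  : ∀ {i a b} → Rotation u (leaf i a b) (leaf i a b)
  at-left  : ∀ {z l r t} → Lift u z l r t → Rotation u (node z l r) t
  at-right : ∀ {z l r t} → ¬ ChildId l u → Lift u z r l t → Rotation u (node z l r) t
  below    : ∀ {z l r l′ r′} → ¬ ChildId l u → ¬ ChildId r u
           → Rotation u l l′ → Rotation u r r′ → Rotation u (node z l r) (node z l′ r′)

rotation : ∀ u t → Rotation u t (rotRaw u t)
rotation u (leaf i a b) = at-leaf
rotation u (node z l r) with try u z l r in e₁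
... | just t = at-left (try⇒lift l r e₁)
... | nothing with try u z r l in e₂
...   | just t = at-right (try-nothing l r e₁) (try⇒lift r l e₂)
...   | nothing = below (try-nothing l r e₁) (try-nothing r l e₂) (rotation u l) (rotation u r)

module Contents {X : Set} (g : TT → List X) (pre : ℕ → List X)
                (g-node : ∀ i l r → g (node i l r) ≡ pre i ++ g l ++ g r) where

  g-outer : ∀ z y a b o → g (node z (node y a b) o) ≡ pre z ++ pre y ++ g a ++ g b ++ g o
  g-outer z y a b o rewrite g-node z (node y a b) o | g-node y a b =
    cong (pre z ++_) (trans (List.++-assoc (pre y) _ _) (cong (pre y ++_) (List.++-assoc (g a) _ _)))

  g-inner : ∀ z y a b o → g (node z a (node y b o)) ≡ pre z ++ g a ++ pre y ++ g b ++ g o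
  g-inner z y a b o rewrite g-node z a (node y b o) | g-node y b o = refl

  lift-↭ : ∀ {u z y o r} → Lift u z y o r → g r ↭ g (node z y o)
  lift-↭ {z = z} (lift-left {y} {a} {b} {o} _)
    rewrite g-inner z y a b o | g-outer z y a b o = ++⁺ˡ (pre z) (shifts (g a) (pre y))
  lift-↭ {z = z} (lift-right {y} {a} {b} {o} _)
    rewrite g-inner z y b a o | g-outer z y a b o =
      ++⁺ˡ (pre z) (↭-trans (shifts (g b) (pre y)) (++⁺ˡ (pre y) (shifts (g b) (g a))))

  rotation-↭ : ∀ {u t t′} → Rotation u t t′ → g t′ ↭ g t
  rotation-↭ at-leaf = ↭-refl
  rotation-↭ (at-left lift) = lift-↭ lift
  rotation-↭ (at-right {z} {l} {r} _ lift) rewrite g-node z l r =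
    ↭-trans (lift-↭ lift)
            (subst (_↭ pre z ++ g l ++ g r) (sym (g-node z r l)) (++⁺ˡ (pre z) (++-comm (g r) (g l))))
  rotation-↭ (below {z} {l} {r} {l′} {r′} _ _ rl rr) rewrite g-node z l r | g-node z l′ r′ =
    ++⁺ˡ (pre z) (++⁺ (rotation-↭ rl) (rotation-↭ rr))

open Contents ids (λ i → i ∷ []) (λ _ _ _ → refl) using () renaming (rotation-↭ to rotation-ids-↭)
open Contents leafList (λ _ → []) (λ _ _ _ → refl) using () renaming (rotation-↭ to rotation-leaves-↭)

rotation-fixes : ∀ {u t t′} → Rotation u t t′ → u ∉ inner t → t′ ≡ t
rotation-fixes at-leaf _ = refl
rotation-fixes (at-left {l = l} lift) u∉ =
  ⊥-elim (u∉ (∈-++⁺ˡ (inner⊆ids l (childId∈inner (lift-childId lift)))))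
rotation-fixes (at-right {l = l} {r} _ lift) u∉ =
  ⊥-elim (u∉ (∈-++⁺ʳ (ids l) (inner⊆ids r (childId∈inner (lift-childId lift)))))
rotation-fixes (below {z} {l} {r} _ _ rl rr) u∉ =
  cong₂ (node z) (rotation-fixes rl (u∉ ∘ ∈-++⁺ˡ ∘ inner⊆ids l))
                 (rotation-fixes rr (u∉ ∘ ∈-++⁺ʳ (ids l) ∘ inner⊆ids r))

lift-keeps-lifted : ∀ {u z y o r w} → Lift u z y o r → w ⊑ y → u ∉ inner w → w ⊑ r
lift-keeps-lifted lift ⊑-here u∉ = ⊥-elim (u∉ (childId∈inner (lift-childId lift)))
lift-keeps-lifted (lift-left _) (⊑-left p) _ = ⊑-left p
lift-keeps-lifted (lift-left _) (⊑-right p) _ = ⊑-right (⊑-left p)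
lift-keeps-lifted (lift-right _) (⊑-left p) _ = ⊑-right (⊑-left p)
lift-keeps-lifted (lift-right _) (⊑-right p) _ = ⊑-left p

lift-keeps-other : ∀ {u z y o r w} → Lift u z y o r → w ⊑ o → w ⊑ r
lift-keeps-other (lift-left _) p = ⊑-right (⊑-right p)
lift-keeps-other (lift-right _) p = ⊑-right (⊑-right p)

rotation-keeps : ∀ {u t t′ w} → Rotation u t t′ → w ⊑ t → u ∉ inner w → w ⊑ t′
rotation-keeps rot ⊑-here u∉ = subst (_ ⊑_) (sym (rotation-fixes rot u∉)) ⊑-here
rotation-keeps (at-left lift) (⊑-left p) u∉ = lift-keeps-lifted lift p u∉
rotation-keeps (at-left lift) (⊑-right p) _ = lift-keeps-other lift p
rotation-keeps (at-right _ lift) (⊑-left p) _ = lift-keeps-other lift p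
rotation-keeps (at-right _ lift) (⊑-right p) u∉ = lift-keeps-lifted lift p u∉
rotation-keeps (below _ _ rl _) (⊑-left p) u∉ = ⊑-left (rotation-keeps rl p u∉)
rotation-keeps (below _ _ _ rr) (⊑-right p) u∉ = ⊑-right (rotation-keeps rr p u∉)

below-not-childId : ∀ {u p y} → DistinctIds y → p ⊑ y → u ∈ inner p → ¬ ChildId p u → ¬ ChildId y u
below-not-childId _ ⊑-here _ ¬c = ¬c
below-not-childId (distinct-node _ _ _ dl _) (⊑-left q) u∈ _ (_ , inj₁ refl , refl) = root∉inner dl (⊑-inner q u∈)
below-not-childId {p = p} (distinct-node _ _ disj _ _) (⊑-left q) u∈ _ (_ , inj₂ refl , refl) =
  disj (⊑-ids q (inner⊆ids p u∈) , idOf∈ids _)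
below-not-childId {p = p} (distinct-node _ _ disj _ _) (⊑-right q) u∈ _ (_ , inj₁ refl , refl) =
  disj (idOf∈ids _ , ⊑-ids q (inner⊆ids p u∈))
below-not-childId (distinct-node _ _ _ _ dr) (⊑-right q) u∈ _ (_ , inj₂ refl , refl) = root∉inner dr (⊑-inner q u∈)

rotation-local : ∀ {u t t′ p} → DistinctIds t → Rotation u t t′ → p ⊑ t → u ∈ inner p → ¬ ChildId p u
               → ∃ λ p′ → p′ ⊑ t′ × Rotation u p p′
rotation-local _ rot ⊑-here _ _ = _ , ⊑-here , rot
rotation-local (distinct-node _ _ _ dl _) (at-left lift) (⊑-left q) u∈ ¬c =
  ⊥-elim (below-not-childId dl q u∈ ¬c (lift-childId lift))
rotation-local {p = p} (distinct-node _ _ disj _ _) (at-left lift) (⊑-right q) u∈ _ =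
  ⊥-elim (disj (inner⊆ids _ (childId∈inner (lift-childId lift)) , ⊑-ids q (inner⊆ids p u∈)))
rotation-local {p = p} (distinct-node _ _ disj _ _) (at-right {r = r} _ lift) (⊑-left q) u∈ _ =
  ⊥-elim (disj (⊑-ids q (inner⊆ids p u∈) , inner⊆ids r (childId∈inner (lift-childId lift))))
rotation-local (distinct-node _ _ _ _ dr) (at-right _ lift) (⊑-right q) u∈ ¬c =
  ⊥-elim (below-not-childId dr q u∈ ¬c (lift-childId lift))
rotation-local (distinct-node _ _ _ dl _) (below _ _ rl _) (⊑-left q) u∈ ¬c =
  Product.map₂ (Product.map₁ ⊑-left) (rotation-local dl rl q u∈ ¬c)
rotation-local (distinct-node _ _ _ _ dr) (below _ _ _ rr) (⊑-right q) u∈ ¬c =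
  Product.map₂ (Product.map₁ ⊑-right) (rotation-local dr rr q u∈ ¬c)

rotation-lifts-left : ∀ {t t′ p nd x y s} → DistinctIds t → node p (node nd x y) s ⊑ t
                    → Rotation (idOf x) t t′ → node p x (node nd y s) ⊑ t′
rotation-lifts-left {p = p} {nd} {x} {y} {s} d P⊑ rot =
  let (P′ , P′⊑ , rotP) = rotation-local d rot P⊑ (∈-++⁺ˡ x∈N) (x-not-child dP)
  in subst (_⊑ _) (at-root dP rotP) P′⊑
  where
  P = node p (node nd x y) s
  dP = ⊑-distinct d P⊑
  x∈N : idOf x ∈ ids (node nd x y)
  x∈N = there (∈-++⁺ˡ (idOf∈ids x))
  x-not-child : DistinctIds P → ¬ ChildId P (idOf x)
  x-not-child (distinct-node _ _ _ (distinct-node nd∉x _ _ _ _) _) (_ , inj₁ refl , e) =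
    nd∉x (subst (_∈ ids x) (sym e) (idOf∈ids x))
  x-not-child (distinct-node _ _ disj _ _) (_ , inj₂ refl , e) = disj (x∈N , subst (_∈ ids s) e (idOf∈ids s))
  at-root : ∀ {P′} → DistinctIds P → Rotation (idOf x) P P′ → P′ ≡ node p x (node nd y s)
  at-root _ (at-left (lift-left _)) = refl
  at-root (distinct-node _ _ _ (distinct-node _ _ disj _ _) _) (at-left (lift-right e)) =
    ⊥-elim (disj (idOf∈ids x , subst (_∈ ids y) e (idOf∈ids y)))
  at-root _ (at-right ¬c _) = ⊥-elim (¬c (_ , inj₁ refl , refl))
  at-root _ (below ¬c _ _ _) = ⊥-elim (¬c (_ , inj₁ refl , refl))

rotation-lifts-right : ∀ {t t′ p nd x y s} → DistinctIds t → node p s (node nd x y) ⊑ t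
                     → Rotation (idOf y) t t′ → node p y (node nd x s) ⊑ t′
rotation-lifts-right {p = p} {nd} {x} {y} {s} d P⊑ rot =
  let (P′ , P′⊑ , rotP) = rotation-local d rot P⊑ (∈-++⁺ʳ (ids s) y∈N) (y-not-child dP)
  in subst (_⊑ _) (at-root dP rotP) P′⊑
  where
  P = node p s (node nd x y)
  dP = ⊑-distinct d P⊑
  y∈N : idOf y ∈ ids (node nd x y)
  y∈N = there (∈-++⁺ʳ (ids x) (idOf∈ids y))
  y-not-child : DistinctIds P → ¬ ChildId P (idOf y)
  y-not-child (distinct-node _ _ disj _ _) (_ , inj₁ refl , e) = disj (subst (_∈ ids s) e (idOf∈ids s) , y∈N)
  y-not-child (distinct-node _ _ _ _ (distinct-node _ nd∉y _ _ _)) (_ , inj₂ refl , e) =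
    nd∉y (subst (_∈ ids y) (sym e) (idOf∈ids y))
  at-root : ∀ {P′} → DistinctIds P → Rotation (idOf y) P P′ → P′ ≡ node p y (node nd x s)
  at-root (distinct-node _ _ disj _ _) (at-left lift) =
    ⊥-elim (disj (inner⊆ids s (childId∈inner (lift-childId lift)) , y∈N))
  at-root _ (at-right _ (lift-right _)) = refl
  at-root (distinct-node _ _ _ _ (distinct-node _ _ disj _ _)) (at-right _ (lift-left e)) =
    ⊥-elim (disj (idOf∈ids x , subst (_∈ ids y) (sym e) (idOf∈ids y)))
  at-root _ (below _ ¬c _ _) = ⊥-elim (¬c (_ , inj₂ refl , refl))

rotation-lifts-child : ∀ f {t t′ nd x y} → DistinctIds t → attach f (node nd x y) ⊑ t
                     → Rotation (idOf (oChild (side f) x y)) t t′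
                     → node (pid f) (oChild (side f) x y) (node nd (qChild (side f) x y) (sib f)) ⊑ t′
rotation-lifts-child (frame L _ _) = rotation-lifts-left
rotation-lifts-child (frame R _ _) = rotation-lifts-right

reorient-sym : ∀ {a b} → Reorient a b → Reorient b a
reorient-sym leaf-same = leaf-same
reorient-sym leaf-flip = leaf-flip
reorient-sym (node-same p q) = node-same (reorient-sym p) (reorient-sym q)
reorient-sym (node-swap p q) = node-swap (reorient-sym q) (reorient-sym p)

reorient-id : ∀ {a b} → Reorient a b → idOf a ≡ idOf b
reorient-id leaf-same = refl
reorient-id leaf-flip = refl
reorient-id (node-same _ _) = refl
reorient-id (node-swap _ _) = refl

reorient-ids-↭ : ∀ {a b} → Reorient a b → ids a ↭ ids b
reorient-ids-↭ leaf-same = ↭-refl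
reorient-ids-↭ leaf-flip = ↭-refl
reorient-ids-↭ {node i _ _} (node-same p q) = ↭-prep i (++⁺ (reorient-ids-↭ p) (reorient-ids-↭ q))
reorient-ids-↭ {node i l r} (node-swap p q) =
  ↭-prep i (↭-trans (++-comm (ids l) (ids r)) (++⁺ (reorient-ids-↭ q) (reorient-ids-↭ p)))

reorient-⊑ : ∀ {t t′ w} → Reorient t t′ → w ⊑ t → ∃ λ w′ → w′ ⊑ t′ × Reorient w w′
reorient-⊑ r ⊑-here = _ , ⊑-here , r
reorient-⊑ (node-same p _) (⊑-left s) = Product.map₂ (Product.map₁ ⊑-left) (reorient-⊑ p s)
reorient-⊑ (node-same _ q) (⊑-right s) = Product.map₂ (Product.map₁ ⊑-right) (reorient-⊑ q s)
reorient-⊑ (node-swap p _) (⊑-left s) = Product.map₂ (Product.map₁ ⊑-right) (reorient-⊑ p s)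
reorient-⊑ (node-swap _ q) (⊑-right s) = Product.map₂ (Product.map₁ ⊑-left) (reorient-⊑ q s)

reorient-child : ∀ {c c′ ch′} → Reorient c c′ → ChildOf c′ ch′ → ∃ λ ch → ChildOf c ch × Reorient ch ch′
reorient-child (node-same p _) (inj₁ refl) = _ , inj₁ refl , p
reorient-child (node-same _ q) (inj₂ refl) = _ , inj₂ refl , q
reorient-child (node-swap _ q) (inj₁ refl) = _ , inj₂ refl , q
reorient-child (node-swap p _) (inj₂ refl) = _ , inj₁ refl , p

-- A record rather than a function, so that both trees are inferable from the type.
record _⊆ᴸ_ (t t′ : TT) : Set where
  constructor ⊆ᴸ⁺
  field
    leaf-⊆ᴸ : ∀ {j e} → (j , e) ∈ leafList t → ∃ λ e′ → (j , e′) ∈ leafList t′ × SameEdge e e′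
open _⊆ᴸ_

⊆⇒⊆ᴸ : ∀ {t t′} → leafList t ⊆ leafList t′ → t ⊆ᴸ t′
⊆⇒⊆ᴸ sub = ⊆ᴸ⁺ λ m → _ , sub m , inj₁ (refl , refl)

⊆ᴸ-refl : ∀ {t} → t ⊆ᴸ t
⊆ᴸ-refl = ⊆⇒⊆ᴸ (λ m → m)

⊆ᴸ-trans : ∀ {a b c} → a ⊆ᴸ b → b ⊆ᴸ c → a ⊆ᴸ c
⊆ᴸ-trans ab bc = ⊆ᴸ⁺ λ m →
  let (e₁ , m₁ , s₁) = leaf-⊆ᴸ ab m; (e₂ , m₂ , s₂) = leaf-⊆ᴸ bc m₁ in e₂ , m₂ , sameEdge-trans s₁ s₂
  where
  sameEdge-trans : ∀ {e₀ e₁ e₂} → SameEdge e₀ e₁ → SameEdge e₁ e₂ → SameEdge e₀ e₂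
  sameEdge-trans (inj₁ (refl , refl)) s = s
  sameEdge-trans (inj₂ (refl , refl)) (inj₁ (refl , refl)) = inj₂ (refl , refl)
  sameEdge-trans (inj₂ (refl , refl)) (inj₂ (refl , refl)) = inj₁ (refl , refl)

⊆ᴸ-node : ∀ {i i′ l l′ r r′} → l ⊆ᴸ l′ → r ⊆ᴸ r′ → node i l r ⊆ᴸ node i′ l′ r′
⊆ᴸ-node {l = l} {l′} ll rr = ⊆ᴸ⁺ λ m → case ∈-++⁻ (leafList l) m of λ
  { (inj₁ m′) → Product.map₂ (Product.map₁ ∈-++⁺ˡ) (leaf-⊆ᴸ ll m′)
  ; (inj₂ m′) → Product.map₂ (Product.map₁ (∈-++⁺ʳ (leafList l′))) (leaf-⊆ᴸ rr m′) }

reorient-⊆ᴸ : ∀ {a b} → Reorient a b → a ⊆ᴸ b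
reorient-⊆ᴸ leaf-same = ⊆ᴸ-refl
reorient-⊆ᴸ leaf-flip = ⊆ᴸ⁺ λ { (here refl) → _ , here refl , inj₂ (refl , refl) }
reorient-⊆ᴸ (node-same p q) = ⊆ᴸ-node (reorient-⊆ᴸ p) (reorient-⊆ᴸ q)
reorient-⊆ᴸ (node-swap {i} {l} {r} p q) =
  ⊆ᴸ-trans {b = node i r l} (⊆⇒⊆ᴸ (∈-resp-↭ (++-comm (leafList l) (leafList r))))
                            (⊆ᴸ-node (reorient-⊆ᴸ q) (reorient-⊆ᴸ p))

leafIds : TT → List ℕ
leafIds t = map proj₁ (leafList t)

leaf-id∈ids : ∀ t {j e} → (j , e) ∈ leafList t → j ∈ ids t
leaf-id∈ids (leaf i a b) (here refl) = here refl
leaf-id∈ids (node i l r) m with ∈-++⁻ (leafList l) m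
... | inj₁ m′ = there (∈-++⁺ˡ (leaf-id∈ids l m′))
... | inj₂ m′ = there (∈-++⁺ʳ (ids l) (leaf-id∈ids r m′))

leafIds⊆ids : ∀ t → leafIds t ⊆ ids t
leafIds⊆ids t m with ∈-map⁻ proj₁ m
... | _ , m′ , refl = leaf-id∈ids t m′

⊆ᴸ-leafIds : ∀ {s s′} → s ⊆ᴸ s′ → leafIds s ⊆ leafIds s′
⊆ᴸ-leafIds s⊆s′ m with ∈-map⁻ proj₁ m
... | _ , m′ , refl = ∈-map⁺ proj₁ (proj₁ (proj₂ (leaf-⊆ᴸ s⊆s′ m′)))

sameEdge-inc : ∀ {v e e′} → SameEdge e e′ → Inc v e → Inc v e′
sameEdge-inc (inj₁ (refl , refl)) inc = inc
sameEdge-inc (inj₂ (refl , refl)) inc = Sum.swap inc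

containsAll-⊆ᴸ : ∀ {t t′ v s s′} → ContainsAll t v s → t′ ⊆ᴸ t → s ⊆ᴸ s′ → ContainsAll t′ v s′
containsAll-⊆ᴸ ca t′⊆t s⊆s′ j e m inc =
  let (e₀ , m₀ , same) = leaf-⊆ᴸ t′⊆t m in ⊆ᴸ-leafIds s⊆s′ (ca j e₀ m₀ (sameEdge-inc same inc))

IsConsuming : TT → ℕ → TT → Set
IsConsuming t v c = ContainsAll t v c × (∀ ch → ChildOf c ch → ¬ ContainsAll t v ch)

isConsuming-transport : ∀ {t t′ v c c′} → IsConsuming t v c → t ⊆ᴸ t′ → t′ ⊆ᴸ t → Reorient c c′
                      → IsConsuming t′ v c′
isConsuming-transport (ca , nc) t⊆t′ t′⊆t r = containsAll-⊆ᴸ ca t′⊆t (reorient-⊆ᴸ r) , λ ch′ ch′∈ ca′ →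
  let (ch , ch∈ , rch) = reorient-child r ch′∈
  in nc ch ch∈ (containsAll-⊆ᴸ ca′ t⊆t′ (reorient-⊆ᴸ (reorient-sym rch)))

oChild-child : ∀ d {nd x y} → ChildOf (node nd x y) (oChild d x y)
oChild-child L = inj₁ refl
oChild-child R = inj₂ refl

qChild-child : ∀ d {nd x y} → ChildOf (node nd x y) (qChild d x y)
qChild-child L = inj₂ refl
qChild-child R = inj₁ refl

child-⊑-lifted : ∀ d {p nd x y s ch} → ChildOf (node nd x y) ch
               → ch ⊑ node p (oChild d x y) (node nd (qChild d x y) s)
child-⊑-lifted L (inj₁ refl) = ⊑-left ⊑-here
child-⊑-lifted L (inj₂ refl) = ⊑-right (⊑-left ⊑-here)
child-⊑-lifted R (inj₁ refl) = ⊑-right (⊑-left ⊑-here)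
child-⊑-lifted R (inj₂ refl) = ⊑-left ⊑-here

lifted-⊆ᴸ : ∀ d {p nd x y s} → node nd x y ⊆ᴸ node p (oChild d x y) (node nd (qChild d x y) s)
lifted-⊆ᴸ L {x = x} = ⊆⇒⊆ᴸ ([ ∈-++⁺ˡ , ∈-++⁺ʳ (leafList x) ∘ ∈-++⁺ˡ ]′ ∘ ∈-++⁻ (leafList x))
lifted-⊆ᴸ R {x = x} {y} = ⊆⇒⊆ᴸ ([ ∈-++⁺ʳ (leafList y) ∘ ∈-++⁺ˡ , ∈-++⁺ˡ ]′ ∘ ∈-++⁻ (leafList x))

isConsuming-lift : ∀ d {t v p nd x y s} → IsConsuming t v (node nd x y) → Disjoint (ids (node nd x y)) (ids s)
                 → IsConsuming t v (node p (oChild d x y) (node nd (qChild d x y) s))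
isConsuming-lift d {t} {v} {p} {nd} {x} {y} {s} (ca , nc) disj =
  containsAll-⊆ᴸ ca (⊆ᴸ-refl {t}) (lifted-⊆ᴸ d {p} {nd} {x} {y} {s}) , λ
    { _ (inj₁ refl) → nc _ (oChild-child d {nd})
    ; _ (inj₂ refl) ca′ → nc _ (qChild-child d {nd}) (λ j e m inc → within-q (ca j e m inc) (ca′ j e m inc)) }
  where
  q = qChild d x y
  within-q : ∀ {j} → j ∈ leafIds (node nd x y) → j ∈ leafIds (node nd q s) → j ∈ leafIds q
  within-q j∈N j∈K with ∈-map⁻ proj₁ j∈K
  ... | _ , m , refl with ∈-++⁻ (leafList q) m
  ...   | inj₁ m′ = ∈-map⁺ proj₁ m′
  ...   | inj₂ m′ = ⊥-elim (disj (leafIds⊆ids (node nd x y) j∈N , leaf-id∈ids s m′))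

rotUp-unique : ∀ {F E u t t′} → RotUp F E u t t′ → Unique (ids t) → Unique (ids t′)
rotUp-unique {u = u} {t} (r , _) =
  unique-resp-↭ (↭-trans (↭-sym (rotation-ids-↭ (rotation u t))) (reorient-ids-↭ r))

rotUp-⊆ᴸ : ∀ {F E u t t′} → RotUp F E u t t′ → t ⊆ᴸ t′ × t′ ⊆ᴸ t
rotUp-⊆ᴸ {u = u} {t} (r , _) =
  ⊆ᴸ-trans (⊆⇒⊆ᴸ (∈-resp-↭ (↭-sym leaves-↭))) (reorient-⊆ᴸ r) ,
  ⊆ᴸ-trans (reorient-⊆ᴸ (reorient-sym r)) (⊆⇒⊆ᴸ (∈-resp-↭ leaves-↭))
  where
  leaves-↭ = rotation-leaves-↭ (rotation u t)

data Invariant (v : ℕ) : State → Set where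
  invariant : ∀ {t nd cc n c} → Unique (ids t) → n ⊑ t → idOf n ≡ nd → c ⊑ n → idOf c ≡ cc
            → IsConsuming t v c → Invariant v (st t nd cc)

relocate : ∀ {F E v u t t′ n c nd cc} → Unique (ids t) → RotUp F E u t t′
         → n ⊑ rotRaw u t → idOf n ≡ nd → c ⊑ n → idOf c ≡ cc → IsConsuming t v c
         → Invariant v (st t′ nd cc)
relocate {u = u} {t} uniq rot n⊑ refl c⊑n refl k with reorient-⊑ (proj₁ rot) n⊑
... | n′ , n′⊑ , rn with reorient-⊑ rn c⊑n
... | c′ , c′⊑ , rc =
  invariant (rotUp-unique {u = u} {t} rot uniq) n′⊑ (sym (reorient-id rn)) c′⊑ (sym (reorient-id rc))
            (isConsuming-transport k t⊆t′ t′⊆t rc)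
  where
  t⊆t′ = proj₁ (rotUp-⊆ᴸ {u = u} {t} rot)
  t′⊆t = proj₂ (rotUp-⊆ᴸ {u = u} {t} rot)

rotate-child : ∀ f {F E v t t′ nd x y c} → Unique (ids t) → attach f (node nd x y) ⊑ t → c ⊑ node nd x y
             → IsConsuming t v c → RotUp F E (idOf (oChild (side f) x y)) t t′
             → Invariant v (st t′ (pid f) (if nd ≡ᵇ idOf c then pid f else idOf c))
rotate-child f {v = v} {t} {t′} {nd} {x} {y} uniq P⊑ c⊑ k rot = by-consumer c⊑ k
  where
  u = idOf (oChild (side f) x y)
  d = unique⇒distinct uniq
  K⊑ : node (pid f) (oChild (side f) x y) (node nd (qChild (side f) x y) (sib f)) ⊑ rotRaw u t
  K⊑ = rotation-lifts-child f d P⊑ (rotation u t)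
  below-root : ∀ {ch c} → ChildOf (node nd x y) ch → c ⊑ ch → nd ≢ idOf c
  below-root ch∈ q = child-⊑-id≢ (⊑-distinct d (⊑-trans (⊑-attach f _) P⊑)) ch∈ q
  by-consumer : ∀ {c} → c ⊑ node nd x y → IsConsuming t v c
              → Invariant v (st t′ (pid f) (if nd ≡ᵇ idOf c then pid f else idOf c))
  by-consumer ⊑-here k rewrite ≡⇒≡ᵇ≡true {nd} refl =
    relocate {u = u} {t} uniq rot K⊑ refl ⊑-here refl
             (isConsuming-lift (side f) {t} {v} {pid f} k (attach-disjoint f (⊑-distinct d P⊑)))
  by-consumer (⊑-left q) k rewrite ≢⇒≡ᵇ≡false (below-root (inj₁ refl) q) =
    relocate {u = u} {t} uniq rot K⊑ refl (⊑-trans q (child-⊑-lifted (side f) (inj₁ refl))) refl k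
  by-consumer (⊑-right q) k rewrite ≢⇒≡ᵇ≡false (below-root (inj₂ refl) q) =
    relocate {u = u} {t} uniq rot K⊑ refl (⊑-trans q (child-⊑-lifted (side f) (inj₂ refl))) refl k

step-preserves : ∀ {F E v σ σ′} → Step F E σ σ′ → Invariant v σ → Invariant v σ′
step-preserves (up-point {f = f} p _) (invariant uniq n⊑ n-id c⊑n c-id k) with path-unique uniq p n⊑ n-id
... | refl = invariant uniq (path-parent p refl) (attach-id f _) (⊑-trans c⊑n (⊑-attach f _)) c-id k
step-preserves (rot-node p _ _ _ _ rot) (invariant uniq n⊑ n-id c⊑n c-id k) with path-unique uniq p n⊑ n-id
... | refl = relocate uniq rot (rotation-keeps (rotation _ _) n⊑ nd∉inner) n-id c⊑n c-id k
  where
  nd∉inner = root∉inner (⊑-distinct (unique⇒distinct uniq) n⊑)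
step-preserves (rot-sib {nd = nd} {x = x} {y} {f} p _ _ _ _ rot) (invariant uniq n⊑ n-id c⊑n c-id k)
  with path-unique uniq p n⊑ n-id
... | refl = relocate uniq rot (rotation-keeps (rotation _ _) n⊑ sib∉inner) n-id c⊑n c-id k
  where
  sib∉inner : idOf (sib f) ∉ inner (node nd x y)
  sib∉inner m =
    attach-disjoint f (⊑-distinct (unique⇒distinct uniq) (path-parent p refl)) (there m , idOf∈ids (sib f))
step-preserves (rot-child {f = f} p _ _ rot) (invariant uniq n⊑ n-id c⊑n refl k) with path-unique uniq p n⊑ n-id
... | refl = rotate-child f uniq (path-parent p refl) c⊑n k rot

run-preserves : ∀ {F E v σ σ′} → Star (Step F E) σ σ′ → Invariant v σ → Invariant v σ′
run-preserves ε inv = inv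
run-preserves (s ◅ ss) inv = run-preserves ss (step-preserves s inv)

lemmaA2 : (F : List Edge) (E : ℕ → Bool) (t : TT) (v c : ℕ)
    → IsForest F → TopTree F E t → OrientInv F E t → AtMostOneExposed E t
    → v ∈ verts (leaves t) → E v ≡ false
    → Consuming t v c
    → ∀ t′ nd c′ → Star (Step F E) (st t c c) (st t′ nd c′) → idOf t′ ≡ nd
    → Consuming t′ v c′
lemmaA2 F E t v c _ topTree _ _ _ _ (_ , _ , path , k) t′ nd c′ steps _
  with run-preserves steps (invariant (proj₁ topTree) (path⇒⊑ path) (path-id path) ⊑-here (path-id path) k)
... | invariant _ n⊑ _ c⊑n refl k′ =
  let (fs , path′) = ⊑⇒path (⊑-trans c⊑n n⊑) in _ , fs , path′ , k′
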